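{- Let $\beta$ be a constant with $0<\beta<1$. For $n$ such that $\beta\log_2 n$ is a positive integer dividing $n$, let $f$ be a read-once DNF formula on $n$ variables in which every term has exactly $\beta\log_2 n$ (unnegated) variables and every variable appears in exactly one term. Then, as $n\to\infty$, $E_f[OPT] = \Omega(n^\beta)$ and $E_f[CERT] = O(\log n)$.
   Context: For a Boolean function $f$ on $n$ variables, consider unit costs and the uniform distribution on $x\in\{0,1\}^n$ (each $x_i$ independently $1$ with probability $1/2$). $E_f[OPT]$ is the minimum, over all adaptive testing strategies (decision trees) computing $f$, of the expected number of variables tested on random $x$. A partial assignment $b\in\{0,1,*\}^n$ is a certificate of $f$ if $f$ is constant on all $a$ agreeing with $b$ on its non-$*$ positions; its size is the number of non-$*$ positions; $x$ contains $b$ if $x_i=b_i$ whenever $b_i\neq *$. $E_f[CERT]$ is the expected value, over uniform random $x$, of the minimum size of a certificate of $f$ contained in $x$. A read-once DNF is a DNF in which each variable appears at most once. -}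

module Defs where

open import Data.Nat using (ℕ; zero; suc; _+_; _*_; _⊔_; _⊓_)
open import Data.Bool using (Bool; true; false; _∧_; _∨_; not; if_then_else_)
open import Data.Fin using (Fin; zero; suc; _≟_)
open import Data.Vec using (Vec; []; _∷_; lookup)
open import Data.List using (List; []; _∷_; map; foldr; concatMap; length; filter)
open import Data.Nat.ListAction using (sum)
open import Data.Bool.ListAction using (all; any)
open import Data.List.Membership.Propositional using (_∈_)
open import Data.Product using (_×_)
open import Data.Maybe using (Maybe; just; nothing)
open import Relation.Nullary using (does)
open import Relation.Binary.PropositionalEquality using (_≡_)

Input : ℕ → Set
Input n = Vec Bool n

BoolFun : ℕ → Set
BoolFun n = Input n → Bool

inputs : (n : ℕ) → List (Input n)
inputs zero    = [] ∷ []
inputs (suc n) = concatMap (λ v → (false ∷ v) ∷ (true ∷ v) ∷ []) (inputs n)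

-- Σ_{x ∈ {0,1}^n} g x   (so that E[g] = sumInputs n g / 2^n under the uniform distribution)
sumInputs : (n : ℕ) → (Input n → ℕ) → ℕ
sumInputs n g = sum (map g (inputs n))

_==ᵇ_ : Bool → Bool → Bool
true  ==ᵇ b = b
false ==ᵇ b = not b

-- Adaptive testing strategies = decision trees (unit cost per test)

data DTree (n : ℕ) : Set where
  leaf : Bool → DTree n
  test : Fin n → (ifFalse ifTrue : DTree n) → DTree n

evalDT : ∀ {n} → DTree n → Input n → Bool
evalDT (leaf b) x = b
evalDT (test i t₀ t₁) x = if lookup x i then evalDT t₁ x else evalDT t₀ x

costDT : ∀ {n} → DTree n → Input n → ℕ
costDT (leaf b) x = 0
costDT (test i t₀ t₁) x = suc (if lookup x i then costDT t₁ x else costDT t₀ x)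

Computes : ∀ {n} → DTree n → BoolFun n → Set
Computes T f = ∀ x → evalDT T x ≡ f x

-- 2^n * (expected cost of T on uniform random x)
totalCost : ∀ {n} → DTree n → ℕ
totalCost {n} T = sumInputs n (costDT T)

Partial : ℕ → Set
Partial n = Vec (Maybe Bool) n

agrees : ∀ {n} → Input n → Partial n → Bool
agrees [] [] = true
agrees (a ∷ as) (nothing ∷ bs) = agrees as bs
agrees (a ∷ as) (just c ∷ bs) = (a ==ᵇ c) ∧ agrees as bs

size : ∀ {n} → Partial n → ℕ
size [] = 0
size (nothing ∷ bs) = size bs
size (just _ ∷ bs) = suc (size bs)

isCertificate : ∀ {n} → BoolFun n → Partial n → Bool
isCertificate {n} f b =
  all (λ a → all (λ a' → not (agrees a b ∧ agrees a' b) ∨ (f a ==ᵇ f a')) (inputs n)) (inputs n)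

subsOf : ∀ {n} → Input n → List (Partial n)
subsOf [] = [] ∷ []
subsOf (a ∷ as) = concatMap (λ b → (nothing ∷ b) ∷ (just a ∷ b) ∷ []) (subsOf as)

-- minimum size of a certificate of f contained in x
-- (x itself, as a full assignment of size n, is always a certificate)
minCert : ∀ {n} → BoolFun n → Input n → ℕ
minCert {n} f x =
  foldr (λ b m → if isCertificate f b then size b ⊓ m else m) n (subsOf x)

-- 2^n * E_f[CERT]
totalCert : ∀ {n} → BoolFun n → ℕ
totalCert {n} f = sumInputs n (minCert f)

-- Monotone DNF formulas: a list of terms, each a list of (unnegated) variables

DNF : ℕ → Set
DNF n = List (List (Fin n))

evalDNF : ∀ {n} → DNF n → BoolFun n
evalDNF F x = any (λ t → all (λ i → lookup x i) t) F

occurrences : ∀ {n} → Fin n → DNF n → ℕ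
occurrences i F = sum (map (λ t → length (filter (λ j → i ≟ j) t)) F)

RegularReadOnce : ∀ {n} → ℕ → DNF n → Set
RegularReadOnce {n} k F =
  (∀ t → t ∈ F → length t ≡ k) × (∀ (i : Fin n) → occurrences i F ≡ 1)

module Submission where

-- Probabilities over the uniform cube are represented as counts over its 2^n points.
--
-- Whether a decision tree T touches (tests a variable of) a term t is
-- decided before any variable of t is read, so among the inputs on which T touches t,
-- t is satisfied with probability exactly 2^-k (touchedTermProbability).  When F(x) = 1,
-- T touches some term satisfied by x (touchedSatisfiedTerm), and by read-onceness each
-- test touches at most one term (touchedTerms≤cost); hence E[cost] ≥ 2^k Pr[F = 1]
-- (costLowerBound).  A satisfied term is a certificate of size k and the
-- whole input one of size n, so E[CERT] ≤ k Pr[F = 1] + n Pr[F = 0] (certificateBound).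
-- Both bounds are closed by Pr[F = 0] = (1 - 2^-k)^m (zeros-readOnce), which the estimate
-- (1 + 1/b)^(bj) ≥ 2^j (growth) makes at most 1/n once m ≥ 2^k · n₀ k (fewZeros).

open import Defs
open import Data.Nat
  using (ℕ; zero; suc; _+_; _*_; _^_; _∸_; _⊓_; _≤_; _<_; z≤n; s≤s; >-nonZero; _/_; _%_)
open import Data.Nat.Properties hiding (_≟_)
open import Data.Nat.Divisibility using (_∣_)
open import Data.Nat.DivMod using (m≡m%n+[m/n]*n; m%n<n; m*n/n≡m; m/n*n≤m; /-monoˡ-≤)
open import Data.Nat.Logarithm using (⌈log₂_⌉; ⌈log₂⌉-mono-≤; ⌈log₂2^n⌉≡n)
open import Data.Nat.ListAction using (sum)
open import Data.Nat.Solver using (module +-*-Solver)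
open import Data.Bool using (Bool; true; false; _∧_; _∨_; not; if_then_else_) renaming (T to IsTrue)
open import Data.Bool.Properties using (if-float; ∧-identityʳ; T-∧; T-≡)
open import Data.Bool.ListAction using (all; any)
open import Data.Product using (_×_; _,_; proj₁; proj₂; ∃-syntax)
open import Data.Maybe using (just; nothing)
open import Data.Empty using (⊥-elim)
open import Data.Fin using (Fin; zero; suc; _≟_)
open import Data.Vec using ([]; _∷_; lookup; tabulate; replicate; _[_]≔_)
open import Data.Vec.Properties
  using (lookup∘update; lookup∘update′; lookup∘tabulate; lookup-replicate)
open import Data.List using (List; []; _∷_; map; foldr; concatMap; length; filter; allFin)
open import Data.List.Properties using (map-tabulate; length-tabulate)
open import Data.List.Membership.Propositional using (_∈_; find; lose)
open import Data.List.Relation.Unary.Any using (here; there; any?)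
open import Data.List.Relation.Unary.Any.Properties using (any⁺; any⁻)
open import Data.List.Relation.Unary.All as All using (All; []; _∷_)
open import Data.List.Relation.Unary.All.Properties using (¬Any⇒All¬; all⁺; all⁻)
open import Data.List.Relation.Unary.AllPairs using ([]; _∷_)
open import Data.List.Relation.Unary.Unique.Propositional using (Unique)
open import Function using (id)
open import Function.Bundles using (Equivalence)
open import Relation.Nullary using (¬_; Dec; does; yes; no)
open import Relation.Nullary.Decidable using (dec-true; isYes; toWitness; fromWitness)
open import Relation.Binary.PropositionalEquality
  using (_≡_; refl; sym; trans; cong; cong₂; subst; subst₂; ≢-sym; module ≡-Reasoning)
open +-*-Solver

sumOver : ∀ {A : Set} → List A → (A → ℕ) → ℕ
sumOver L g = sum (map g L)

module _ {A : Set} where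

  sumOver-cong∈ : ∀ (L : List A) {f g : A → ℕ} → (∀ x → x ∈ L → f x ≡ g x) →
    sumOver L f ≡ sumOver L g
  sumOver-cong∈ []      e = refl
  sumOver-cong∈ (x ∷ L) e = cong₂ _+_ (e x (here refl)) (sumOver-cong∈ L (λ y m → e y (there m)))

  sumOver-cong : ∀ (L : List A) {f g : A → ℕ} → (∀ x → f x ≡ g x) → sumOver L f ≡ sumOver L g
  sumOver-cong L e = sumOver-cong∈ L (λ x _ → e x)

  sumOver-const : ∀ (L : List A) c → sumOver L (λ _ → c) ≡ c * length L
  sumOver-const []      c = sym (*-zeroʳ c)
  sumOver-const (x ∷ L) c = trans (cong (c +_) (sumOver-const L c)) (sym (*-suc c (length L)))

  sumOver-+ : ∀ (L : List A) (f g : A → ℕ) →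
    sumOver L (λ x → f x + g x) ≡ sumOver L f + sumOver L g
  sumOver-+ []      f g = refl
  sumOver-+ (x ∷ L) f g = trans (cong (f x + g x +_) (sumOver-+ L f g))
    (solve 4 (λ a b c d → (a :+ b) :+ (c :+ d) := (a :+ c) :+ (b :+ d)) refl
      (f x) (g x) (sumOver L f) (sumOver L g))

  sumOver-* : ∀ (L : List A) c (f : A → ℕ) → sumOver L (λ x → c * f x) ≡ c * sumOver L f
  sumOver-* []      c f = sym (*-zeroʳ c)
  sumOver-* (x ∷ L) c f =
    trans (cong (c * f x +_) (sumOver-* L c f)) (sym (*-distribˡ-+ c (f x) (sumOver L f)))

  sumOver-mono : ∀ (L : List A) {f g : A → ℕ} → (∀ x → f x ≤ g x) → sumOver L f ≤ sumOver L g
  sumOver-mono []      e = z≤n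
  sumOver-mono (x ∷ L) e = +-mono-≤ (e x) (sumOver-mono L e)

  summand≤sumOver : ∀ {L : List A} {x : A} (g : A → ℕ) → x ∈ L → g x ≤ sumOver L g
  summand≤sumOver {y ∷ L} g (here refl) = m≤m+n (g y) _
  summand≤sumOver {y ∷ L} g (there m)   = ≤-trans (summand≤sumOver g m) (m≤n+m _ (g y))

  sumOver-swap : ∀ {B : Set} (L : List A) (M : List B) (g : A → B → ℕ) →
    sumOver L (λ x → sumOver M (g x)) ≡ sumOver M (λ y → sumOver L (λ x → g x y))
  sumOver-swap L []      g = sumOver-const L 0
  sumOver-swap L (y ∷ M) g = trans (sumOver-+ L (λ x → g x y) (λ x → sumOver M (g x)))
    (cong (sumOver L (λ x → g x y) +_) (sumOver-swap L M g))

-- Sums over the Boolean cube {0,1}^n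

sumInputs-suc : ∀ n (g : Input (suc n) → ℕ) →
  sumInputs (suc n) g ≡ sumInputs n (λ v → g (false ∷ v) + g (true ∷ v))
sumInputs-suc n g = split (inputs n)
  where
  split : ∀ (l : List (Input n)) →
    sumOver (concatMap (λ v → (false ∷ v) ∷ (true ∷ v) ∷ []) l) g
      ≡ sumOver l (λ v → g (false ∷ v) + g (true ∷ v))
  split []      = refl
  split (v ∷ l) = trans (sym (+-assoc (g (false ∷ v)) (g (true ∷ v)) _))
    (cong (g (false ∷ v) + g (true ∷ v) +_) (split l))

sumInputs-1 : ∀ n → sumInputs n (λ _ → 1) ≡ 2 ^ n
sumInputs-1 zero    = refl
sumInputs-1 (suc n) = trans (sumInputs-suc n (λ _ → 1))
  (trans (sumOver-* (inputs n) 2 (λ _ → 1)) (cong (2 *_) (sumInputs-1 n)))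

𝟙 : Bool → ℕ
𝟙 true  = 1
𝟙 false = 0

𝟙-true : ∀ y → 𝟙 true * y ≡ y
𝟙-true y = +-identityʳ y

𝟙-∧ : ∀ a b c → 𝟙 (a ∧ b) * c ≡ 𝟙 a * (𝟙 b * c)
𝟙-∧ true  b c = sym (𝟙-true (𝟙 b * c))
𝟙-∧ false b c = refl

IndependentOf : ∀ {n} → Fin n → (Input n → ℕ) → Set
IndependentOf i w = ∀ x b → w (x [ i ]≔ b) ≡ w x

halfOnCoordinate : ∀ n (i : Fin n) (w : Input n → ℕ) → IndependentOf i w →
  2 * sumInputs n (λ x → 𝟙 (lookup x i) * w x) ≡ sumInputs n w
halfOnCoordinate (suc n) zero w indep = begin
    2 * sumInputs (suc n) (λ x → 𝟙 (lookup x zero) * w x)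
  ≡⟨ cong (2 *_) (sumInputs-suc n _) ⟩
    2 * sumInputs n (λ v → 0 + 𝟙 true * w (true ∷ v))
  ≡⟨ sym (sumOver-* (inputs n) 2 _) ⟩
    sumInputs n (λ v → 2 * (𝟙 true * w (true ∷ v)))
  ≡⟨ sumOver-cong (inputs n) (λ v → trans (cong (2 *_) (𝟙-true (w (true ∷ v))))
       (cong₂ _+_ (sym (indep (true ∷ v) false)) (+-identityʳ _))) ⟩
    sumInputs n (λ v → w (false ∷ v) + w (true ∷ v))
  ≡⟨ sym (sumInputs-suc n w) ⟩
    sumInputs (suc n) w ∎
  where open ≡-Reasoning
halfOnCoordinate (suc n) (suc i) w indep = begin
    2 * sumInputs (suc n) (λ x → 𝟙 (lookup x (suc i)) * w x)
  ≡⟨ cong (2 *_) (sumInputs-suc n _) ⟩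
    2 * sumInputs n (λ v → 𝟙 (lookup v i) * w (false ∷ v) + 𝟙 (lookup v i) * w (true ∷ v))
  ≡⟨ cong (2 *_) (sumOver-cong (inputs n) (λ v →
       sym (*-distribˡ-+ (𝟙 (lookup v i)) (w (false ∷ v)) (w (true ∷ v))))) ⟩
    2 * sumInputs n (λ v → 𝟙 (lookup v i) * w' v)
  ≡⟨ halfOnCoordinate n i w'
       (λ x b → cong₂ _+_ (indep (false ∷ x) b) (indep (true ∷ x) b)) ⟩
    sumInputs n w'
  ≡⟨ sym (sumInputs-suc n w) ⟩
    sumInputs (suc n) w ∎
  where
  open ≡-Reasoning
  w' : Input n → ℕ
  w' v = w (false ∷ v) + w (true ∷ v)

satisfies : ∀ {n} → Input n → List (Fin n) → Bool
satisfies x t = all (lookup x) t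

satisfies-update : ∀ {n} (x : Input n) {i : Fin n} b {t : List (Fin n)} →
  All (λ j → ¬ i ≡ j) t → satisfies (x [ i ]≔ b) t ≡ satisfies x t
satisfies-update x b []         = refl
satisfies-update x b (i≢j ∷ ps) =
  cong₂ _∧_ (lookup∘update′ (≢-sym i≢j) x b) (satisfies-update x b ps)

termProbability : ∀ n (t : List (Fin n)) (w : Input n → ℕ) → Unique t →
  All (λ i → IndependentOf i w) t →
  2 ^ length t * sumInputs n (λ x → 𝟙 (satisfies x t) * w x) ≡ sumInputs n w
termProbability n []      w uniq indep =
  trans (*-identityˡ _) (sumOver-cong (inputs n) (λ x → 𝟙-true (w x)))
termProbability n (i ∷ t) w (i∉t ∷ uniq) (indepᵢ ∷ indep) = begin
    2 * 2 ^ length t * sumInputs n (λ x → 𝟙 (lookup x i ∧ satisfies x t) * w x)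
  ≡⟨ cong (2 * 2 ^ length t *_) (sumOver-cong (inputs n) (λ x →
       𝟙-∧ (lookup x i) (satisfies x t) (w x))) ⟩
    2 * 2 ^ length t * sumInputs n (λ x → 𝟙 (lookup x i) * wₜ x)
  ≡⟨ solve 3 (λ a b c → (a :* b) :* c := b :* (a :* c)) refl 2 (2 ^ length t) _ ⟩
    2 ^ length t * (2 * sumInputs n (λ x → 𝟙 (lookup x i) * wₜ x))
  ≡⟨ cong (2 ^ length t *_) (halfOnCoordinate n i wₜ (λ x b →
       cong₂ _*_ (cong 𝟙 (satisfies-update x b i∉t)) (indepᵢ x b))) ⟩
    2 ^ length t * sumInputs n wₜ
  ≡⟨ termProbability n t w uniq indep ⟩
    sumInputs n w ∎
  where
  open ≡-Reasoning
  wₜ : Input n → ℕ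
  wₜ x = 𝟙 (satisfies x t) * w x

-- Read-once formulas

occurrencesIn : ∀ {n} → Fin n → List (Fin n) → ℕ
occurrencesIn i t = length (filter (λ j → i ≟ j) t)

ReadOnce : ∀ {n} → DNF n → Set
ReadOnce F = ∀ i → occurrences i F ≤ 1

occurrencesIn-∷ : ∀ {n} (i j : Fin n) t →
  occurrencesIn i (j ∷ t) ≡ 𝟙 (does (i ≟ j)) + occurrencesIn i t
occurrencesIn-∷ i j t with does (i ≟ j)
... | true  = refl
... | false = refl

occurrencesIn-∈ : ∀ {n} {i : Fin n} {t} → i ∈ t → 1 ≤ occurrencesIn i t
occurrencesIn-∈ {i = i} {j ∷ t} (here refl)
  rewrite occurrencesIn-∷ i i t | dec-true (i ≟ i) refl = s≤s z≤n
occurrencesIn-∈ {i = i} {j ∷ t} (there p)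
  rewrite occurrencesIn-∷ i j t = ≤-trans (occurrencesIn-∈ p) (m≤n+m _ _)

occurrencesIn≤occurrences : ∀ {n} {i : Fin n} {t} {F : DNF n} → t ∈ F →
  occurrencesIn i t ≤ occurrences i F
occurrencesIn≤occurrences {i = i} = summand≤sumOver (occurrencesIn i)

readOnce-tail : ∀ {n} {t : List (Fin n)} {F} → ReadOnce (t ∷ F) → ReadOnce F
readOnce-tail {t = t} readOnce i = ≤-trans (m≤n+m _ (occurrencesIn i t)) (readOnce i)

unique-term : ∀ {n} (t : List (Fin n)) → (∀ i → occurrencesIn i t ≤ 1) → Unique t
unique-term []      once = []
unique-term (j ∷ t) once = ¬Any⇒All¬ t j∉t ∷ unique-term t onceₜ
  where
  j∉t : ¬ j ∈ t
  j∉t j∈t = <⇒≱ (subst (2 ≤_) (sym (trans (occurrencesIn-∷ j j t)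
    (cong (λ b → 𝟙 b + occurrencesIn j t) (dec-true (j ≟ j) refl))))
    (s≤s (occurrencesIn-∈ j∈t))) (once j)
  onceₜ : ∀ i → occurrencesIn i t ≤ 1
  onceₜ i = ≤-trans (subst (occurrencesIn i t ≤_) (sym (occurrencesIn-∷ i j t)) (m≤n+m _ _))
              (once i)

readOnce-unique : ∀ {n} {t : List (Fin n)} {F} → ReadOnce F → t ∈ F → Unique t
readOnce-unique {t = t} readOnce t∈F =
  unique-term t (λ i → ≤-trans (occurrencesIn≤occurrences t∈F) (readOnce i))

readOnce-disjoint : ∀ {n} {t : List (Fin n)} {F} → ReadOnce (t ∷ F) →
  ∀ {i} → i ∈ t → All (λ t' → All (λ j → ¬ i ≡ j) t') F
readOnce-disjoint readOnce {i} i∈t =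
  All.tabulate (λ {t'} t'∈F → ¬Any⇒All¬ t' (λ i∈t' →
    <⇒≱ (+-mono-≤ (occurrencesIn-∈ i∈t)
           (≤-trans (occurrencesIn-∈ i∈t') (occurrencesIn≤occurrences t'∈F)))
        (readOnce i)))

evalDNF-update : ∀ {n} (F : DNF n) (x : Input n) {i : Fin n} b →
  All (λ t → All (λ j → ¬ i ≡ j) t) F → evalDNF F (x [ i ]≔ b) ≡ evalDNF F x
evalDNF-update []      x b []         = refl
evalDNF-update (t ∷ F) x b (i∉t ∷ ps) =
  cong₂ _∨_ (satisfies-update x b i∉t) (evalDNF-update F x b ps)

-- The number of zeros of a regular read-once DNF

ones zeros : ∀ {n} → BoolFun n → ℕ
ones  {n} f = sumInputs n (λ x → 𝟙 (f x))
zeros {n} f = sumInputs n (λ x → 𝟙 (not (f x)))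

ones+zeros : ∀ {n} (f : BoolFun n) → ones f + zeros f ≡ 2 ^ n
ones+zeros {n} f = begin
    ones f + zeros f
  ≡⟨ sym (sumOver-+ (inputs n) _ _) ⟩
    sumInputs n (λ x → 𝟙 (f x) + 𝟙 (not (f x)))
  ≡⟨ sumOver-cong (inputs n) (λ x → complementary (f x)) ⟩
    sumInputs n (λ _ → 1)
  ≡⟨ sumInputs-1 n ⟩
    2 ^ n ∎
  where
  open ≡-Reasoning
  complementary : ∀ b → 𝟙 b + 𝟙 (not b) ≡ 1
  complementary true  = refl
  complementary false = refl

-- Adding a term t of size k to a read-once formula multiplies the number of
-- zeros by 1 - 2^-k; here 2^k = b + 1.
zeros-∷ : ∀ n k b → 2 ^ k ≡ suc b → (t : List (Fin n)) (F : DNF n) → length t ≡ k →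
  ReadOnce (t ∷ F) → 2 ^ k * zeros (evalDNF (t ∷ F)) ≡ b * zeros (evalDNF F)
zeros-∷ n k b 2^k≡1+b t F |t|≡k readOnce = +-cancelʳ-≡ _ _ _ (begin
    2 ^ k * Z' + Z
  ≡⟨ cong (2 ^ k * Z' +_) (sym 2^k*P≡Z) ⟩
    2 ^ k * Z' + 2 ^ k * P
  ≡⟨ sym (*-distribˡ-+ (2 ^ k) Z' P) ⟩
    2 ^ k * (Z' + P)
  ≡⟨ cong (2 ^ k *_) (trans (+-comm Z' P) (sym Z≡P+Z')) ⟩
    2 ^ k * Z
  ≡⟨ cong (_* Z) 2^k≡1+b ⟩
    Z + b * Z
  ≡⟨ +-comm Z (b * Z) ⟩
    b * Z + Z ∎)
  where
  open ≡-Reasoning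
  notF : Input n → ℕ
  notF x = 𝟙 (not (evalDNF F x))
  Z Z' P : ℕ
  Z  = zeros (evalDNF F)
  Z' = zeros (evalDNF (t ∷ F))
  P  = sumInputs n (λ x → 𝟙 (satisfies x t) * notF x)
  split : ∀ x → notF x ≡ 𝟙 (satisfies x t) * notF x + 𝟙 (not (evalDNF (t ∷ F) x))
  split x with satisfies x t
  ... | true  = trans (sym (𝟙-true (notF x))) (sym (+-identityʳ _))
  ... | false = refl
  Z≡P+Z' : Z ≡ P + Z'
  Z≡P+Z' = trans (sumOver-cong (inputs n) split) (sumOver-+ (inputs n) _ _)
  -- F ignores the variables of t, so t is satisfied on a 2^-k fraction of the zeros of F
  2^k*P≡Z : 2 ^ k * P ≡ Z
  2^k*P≡Z = subst (λ l → 2 ^ l * P ≡ Z) |t|≡k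
    (termProbability n t notF (readOnce-unique {F = t ∷ F} readOnce (here refl))
      (All.tabulate (λ i∈t x c →
        cong (λ v → 𝟙 (not v))
          (evalDNF-update F x c (readOnce-disjoint {t = t} {F} readOnce i∈t)))))

zeros-readOnce : ∀ n k b → 2 ^ k ≡ suc b → (F : DNF n) → (∀ t → t ∈ F → length t ≡ k) →
  ReadOnce F → (2 ^ k) ^ length F * zeros (evalDNF F) ≡ b ^ length F * 2 ^ n
zeros-readOnce n k b 2^k≡1+b []      sizes readOnce =
  trans (+-identityʳ _) (trans (sumInputs-1 n) (sym (+-identityʳ _)))
zeros-readOnce n k b 2^k≡1+b (t ∷ F) sizes readOnce = begin
    2 ^ k * (2 ^ k) ^ length F * zeros (evalDNF (t ∷ F))
  ≡⟨ solve 3 (λ a c d → (a :* c) :* d := c :* (a :* d)) refl (2 ^ k) _ _ ⟩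
    (2 ^ k) ^ length F * (2 ^ k * zeros (evalDNF (t ∷ F)))
  ≡⟨ cong ((2 ^ k) ^ length F *_) (zeros-∷ n k b 2^k≡1+b t F (sizes t (here refl)) readOnce) ⟩
    (2 ^ k) ^ length F * (b * zeros (evalDNF F))
  ≡⟨ solve 3 (λ c b d → c :* (b :* d) := b :* (c :* d))
       refl ((2 ^ k) ^ length F) b (zeros (evalDNF F)) ⟩
    b * ((2 ^ k) ^ length F * zeros (evalDNF F))
  ≡⟨ cong (b *_) (zeros-readOnce n k b 2^k≡1+b F (λ t' m → sizes t' (there m))
       (readOnce-tail {t = t} {F} readOnce)) ⟩
    b * (b ^ length F * 2 ^ n)
  ≡⟨ sym (*-assoc b _ _) ⟩
    b * b ^ length F * 2 ^ n ∎
  where open ≡-Reasoning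

-- Lower bound for decision trees

path : ∀ {n} → DTree n → Input n → List (Fin n)
path (leaf b)       x = []
path (test i T₀ T₁) x = i ∷ (if lookup x i then path T₁ x else path T₀ x)

_∈?_ : ∀ {n} (i : Fin n) (t : List (Fin n)) → Dec (i ∈ t)
i ∈? t = any? (i ≟_) t

touches : ∀ {n} → List (Fin n) → DTree n → Input n → Bool
touches t T x = any (λ j → isYes (j ∈? t)) (path T x)

𝟙-if : ∀ c (a₁ a₀ : Bool) y →
  𝟙 (if c then a₁ else a₀) * y ≡ 𝟙 a₁ * (𝟙 c * y) + 𝟙 a₀ * (𝟙 (not c) * y)
𝟙-if true  a₁ a₀ y =
  sym (trans (cong₂ _+_ (cong (𝟙 a₁ *_) (𝟙-true y)) (*-zeroʳ (𝟙 a₀))) (+-identityʳ _))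
𝟙-if false a₁ a₀ y = sym (cong₂ _+_ (*-zeroʳ (𝟙 a₁)) (cong (𝟙 a₀ *_) (𝟙-true y)))

sumInputs-branch : ∀ {A : Set} n (i : Fin n) (p₁ p₀ : Input n → A) (g : Input n → A → Bool)
  (w : Input n → ℕ) →
  sumInputs n (λ x → 𝟙 (g x (if lookup x i then p₁ x else p₀ x)) * w x)
    ≡ sumInputs n (λ x → 𝟙 (g x (p₁ x)) * (𝟙 (lookup x i) * w x))
      + sumInputs n (λ x → 𝟙 (g x (p₀ x)) * (𝟙 (not (lookup x i)) * w x))
sumInputs-branch n i p₁ p₀ g w = trans (sumOver-cong (inputs n) (λ x →
    trans (cong (λ b → 𝟙 b * w x) (if-float (g x) (lookup x i)))
          (𝟙-if (lookup x i) (g x (p₁ x)) (g x (p₀ x)) (w x))))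
  (sumOver-+ (inputs n) _ _)

-- Whether T touches t is decided before any variable of t is read, so among the
-- inputs on which T touches t, the term t is still satisfied with probability 2^-|t|.
touchedTermProbability : ∀ n (t : List (Fin n)) (T : DTree n) (w : Input n → ℕ) → Unique t →
  All (λ i → IndependentOf i w) t →
  2 ^ length t * sumInputs n (λ x → 𝟙 (touches t T x ∧ satisfies x t) * w x)
    ≡ sumInputs n (λ x → 𝟙 (touches t T x) * w x)
touchedTermProbability n t (leaf b) w uniq indep =
  trans (cong (2 ^ length t *_) (sumOver-const (inputs n) 0))
    (trans (*-zeroʳ (2 ^ length t)) (sym (sumOver-const (inputs n) 0)))
touchedTermProbability n t (test i T₀ T₁) w uniq indep with i ∈? t
... | yes _ = trans (termProbability n t w uniq indep)
                (sumOver-cong (inputs n) (λ x → sym (𝟙-true (w x))))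
... | no i∉t = begin
    2 ^ length t * sumInputs n (λ x → 𝟙 (touchedSat x (branch x)) * w x)
  ≡⟨ cong (2 ^ length t *_) (sumInputs-branch n i (path T₁) (path T₀) touchedSat w) ⟩
    2 ^ length t * (sumInputs n (λ x → 𝟙 (touchedSat x (path T₁ x)) * w₁ x)
                    + sumInputs n (λ x → 𝟙 (touchedSat x (path T₀ x)) * w₀ x))
  ≡⟨ *-distribˡ-+ (2 ^ length t) _ _ ⟩
    2 ^ length t * sumInputs n (λ x → 𝟙 (touches t T₁ x ∧ satisfies x t) * w₁ x)
      + 2 ^ length t * sumInputs n (λ x → 𝟙 (touches t T₀ x ∧ satisfies x t) * w₀ x)
  ≡⟨ cong₂ _+_ (touchedTermProbability n t T₁ w₁ uniq (indepBranch (λ c → c)))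
               (touchedTermProbability n t T₀ w₀ uniq (indepBranch not)) ⟩
    sumInputs n (λ x → 𝟙 (touched (path T₁ x)) * w₁ x)
      + sumInputs n (λ x → 𝟙 (touched (path T₀ x)) * w₀ x)
  ≡⟨ sym (sumInputs-branch n i (path T₁) (path T₀) (λ _ → touched) w) ⟩
    sumInputs n (λ x → 𝟙 (touched (branch x)) * w x) ∎
  where
  open ≡-Reasoning
  touched : List (Fin n) → Bool
  touched p = any (λ j → isYes (j ∈? t)) p
  touchedSat : Input n → List (Fin n) → Bool
  touchedSat x p = touched p ∧ satisfies x t
  branch : Input n → List (Fin n)
  branch x = if lookup x i then path T₁ x else path T₀ x
  w₁ w₀ : Input n → ℕ
  w₁ x = 𝟙 (lookup x i) * w x
  w₀ x = 𝟙 (not (lookup x i)) * w x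
  -- the tested variable x_i is not in t, so the branch weights still ignore t
  indepBranch : ∀ (sel : Bool → Bool) →
    All (λ j → IndependentOf j (λ x → 𝟙 (sel (lookup x i)) * w x)) t
  indepBranch sel = All.tabulate (λ {j} j∈t x b →
    cong₂ _*_ (cong (λ v → 𝟙 (sel v))
                (lookup∘update′ (λ i≡j → i∉t (subst (_∈ t) (sym i≡j) j∈t)) x b))
              (All.lookup indep j∈t x b))

𝟙-∨ : ∀ a b → 𝟙 (a ∨ b) ≤ 𝟙 a + 𝟙 b
𝟙-∨ true  b = s≤s z≤n
𝟙-∨ false b = ≤-refl

𝟙-∈? : ∀ {n} (i : Fin n) t → 𝟙 (isYes (i ∈? t)) ≤ occurrencesIn i t
𝟙-∈? i t with i ∈? t
... | yes i∈t = occurrencesIn-∈ i∈t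
... | no _    = z≤n

-- In a read-once formula each test touches at most one term, so the number of
-- terms touched on x is at most the cost of T on x.
touchedTerms≤cost : ∀ {n} (F : DNF n) → ReadOnce F → (T : DTree n) →
  ∀ x → sumOver F (λ t → 𝟙 (touches t T x)) ≤ costDT T x
touchedTerms≤cost F readOnce (leaf b)       x = ≤-reflexive (sumOver-const F 0)
touchedTerms≤cost F readOnce (test i T₀ T₁) x = begin
    sumOver F (λ t → 𝟙 (isYes (i ∈? t) ∨ touchedBranch t (lookup x i)))
  ≤⟨ sumOver-mono F (λ t → 𝟙-∨ (isYes (i ∈? t)) _) ⟩
    sumOver F (λ t → 𝟙 (isYes (i ∈? t)) + 𝟙 (touchedBranch t (lookup x i)))
  ≡⟨ sumOver-+ F _ _ ⟩
    sumOver F (λ t → 𝟙 (isYes (i ∈? t))) + sumOver F (λ t → 𝟙 (touchedBranch t (lookup x i)))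
  ≤⟨ +-mono-≤ (≤-trans (sumOver-mono F (𝟙-∈? i)) (readOnce i)) (branchCost (lookup x i)) ⟩
    suc (if lookup x i then costDT T₁ x else costDT T₀ x) ∎
  where
  open ≤-Reasoning
  touchedBranch : List (Fin _) → Bool → Bool
  touchedBranch t c = any (λ j → isYes (j ∈? t)) (if c then path T₁ x else path T₀ x)
  branchCost : ∀ c → sumOver F (λ t → 𝟙 (touchedBranch t c))
                       ≤ (if c then costDT T₁ x else costDT T₀ x)
  branchCost true  = touchedTerms≤cost F readOnce T₁ x
  branchCost false = touchedTerms≤cost F readOnce T₀ x

evalDT-path : ∀ {n} (T : DTree n) x y →
  (∀ j → j ∈ path T x → lookup y j ≡ lookup x j) → evalDT T y ≡ evalDT T x
evalDT-path (leaf b)       x y agree = refl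
evalDT-path (test i T₀ T₁) x y agree rewrite agree i (here refl) with lookup x i
... | true  = evalDT-path T₁ x y (λ j m → agree j (there m))
... | false = evalDT-path T₀ x y (λ j m → agree j (there m))

touches-⊆ : ∀ {n} (t : List (Fin n)) (T : DTree n) x → 1 ≤ length t →
  (∀ {j} → j ∈ t → j ∈ path T x) → IsTrue (touches t T x)
touches-⊆ (j ∷ t) T x _ tested = any⁺ _ (lose (tested (here refl)) (fromWitness (here refl)))

-- If F(x) = 1, then T touches a term of F that x satisfies: otherwise T could not
-- distinguish x from the input y that keeps only the tested ones of x.
touchedSatisfiedTerm : ∀ {n} (F : DNF n) (T : DTree n) → Computes T (evalDNF F) →
  (∀ t → t ∈ F → 1 ≤ length t) → ∀ x → IsTrue (evalDNF F x) →
  ∃[ t ] (t ∈ F × IsTrue (touches t T x ∧ satisfies x t))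
touchedSatisfiedTerm {n} F T computes nonEmpty x Fx =
  t , t∈F , Equivalence.from T-∧ (touches-⊆ t T x (nonEmpty t t∈F) (λ m → proj₂ (onTerm m)) , satX)
  where
  y : Input n
  y = tabulate (λ j → lookup x j ∧ isYes (j ∈? path T x))
  y-agrees : ∀ j → j ∈ path T x → lookup y j ≡ lookup x j
  y-agrees j tested = trans (lookup∘tabulate _ j)
    (trans (cong (lookup x j ∧_) (Equivalence.to T-≡ (fromWitness tested))) (∧-identityʳ _))
  Fy : IsTrue (evalDNF F y)
  Fy = subst IsTrue (sym (trans (sym (computes y))
         (trans (evalDT-path T x y y-agrees) (computes x)))) Fx
  found : ∃[ t ] (t ∈ F × IsTrue (satisfies y t))
  found = find (any⁻ (satisfies y) F Fy)
  t = proj₁ found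
  t∈F = proj₁ (proj₂ found)
  onTerm : ∀ {j} → j ∈ t → IsTrue (lookup x j) × j ∈ path T x
  onTerm {j} j∈t =
    let xⱼ , tested = Equivalence.to T-∧
          (subst IsTrue (lookup∘tabulate _ j)
            (All.lookup (all⁺ (lookup y) t (proj₂ (proj₂ found))) j∈t))
    in xⱼ , toWitness tested
  satX : IsTrue (satisfies x t)
  satX = all⁻ (lookup x) (All.tabulate (λ m → proj₁ (onTerm m)))

𝟙-IsTrue : ∀ {b} → IsTrue b → 1 ≤ 𝟙 b
𝟙-IsTrue {true} _ = ≤-refl

costLowerBound : ∀ n k (F : DNF n) (T : DTree n) → Computes T (evalDNF F) →
  (∀ t → t ∈ F → length t ≡ k) → ReadOnce F → 1 ≤ k →
  2 ^ k * ones (evalDNF F) ≤ totalCost T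
costLowerBound n k F T computes sizes readOnce 1≤k = begin
    2 ^ k * ones (evalDNF F)
  ≤⟨ *-monoʳ-≤ (2 ^ k) (sumOver-mono (inputs n) one≤touchedSatisfied) ⟩
    2 ^ k * sumInputs n (λ x → sumOver F (λ t → 𝟙 (touches t T x ∧ satisfies x t)))
  ≡⟨ cong (2 ^ k *_) (sumOver-swap (inputs n) F _) ⟩
    2 ^ k * sumOver F (λ t → sumInputs n (λ x → 𝟙 (touches t T x ∧ satisfies x t)))
  ≡⟨ sym (sumOver-* F (2 ^ k) _) ⟩
    sumOver F (λ t → 2 ^ k * sumInputs n (λ x → 𝟙 (touches t T x ∧ satisfies x t)))
  ≡⟨ sumOver-cong∈ F perTerm ⟩
    sumOver F (λ t → sumInputs n (λ x → 𝟙 (touches t T x)))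
  ≡⟨ sym (sumOver-swap (inputs n) F _) ⟩
    sumInputs n (λ x → sumOver F (λ t → 𝟙 (touches t T x)))
  ≤⟨ sumOver-mono (inputs n) (touchedTerms≤cost F readOnce T) ⟩
    totalCost T ∎
  where
  open ≤-Reasoning
  one≤touchedSatisfied : ∀ x → 𝟙 (evalDNF F x) ≤ sumOver F (λ t → 𝟙 (touches t T x ∧ satisfies x t))
  one≤touchedSatisfied x with evalDNF F x in Fx
  ... | false = z≤n
  ... | true  =
    let t , t∈F , ts = touchedSatisfiedTerm F T computes
                         (λ t t∈F → subst (1 ≤_) (sym (sizes t t∈F)) 1≤k) x
                         (Equivalence.from T-≡ Fx)
    in ≤-trans (𝟙-IsTrue ts) (summand≤sumOver _ t∈F)
  perTerm : ∀ t → t ∈ F → 2 ^ k * sumInputs n (λ x → 𝟙 (touches t T x ∧ satisfies x t))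
                            ≡ sumInputs n (λ x → 𝟙 (touches t T x))
  perTerm t t∈F = begin-equality
      2 ^ k * sumInputs n (λ x → 𝟙 (touches t T x ∧ satisfies x t))
    ≡⟨ cong₂ (λ l s → 2 ^ l * s) (sym (sizes t t∈F))
         (sumOver-cong (inputs n) (λ x → sym (*-identityʳ _))) ⟩
      2 ^ length t * sumInputs n (λ x → 𝟙 (touches t T x ∧ satisfies x t) * 1)
    ≡⟨ touchedTermProbability n t T (λ _ → 1)
         (readOnce-unique {F = F} readOnce t∈F)
         (All.tabulate (λ _ _ _ → refl)) ⟩
      sumInputs n (λ x → 𝟙 (touches t T x) * 1)
    ≡⟨ sumOver-cong (inputs n) (λ x → *-identityʳ _) ⟩
      sumInputs n (λ x → 𝟙 (touches t T x)) ∎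

-- Certificates

termCertificate : ∀ {n} → List (Fin n) → Partial n
termCertificate {n} t = foldr (λ i b → b [ i ]≔ just true) (replicate n nothing) t

size-update : ∀ {n} (b : Partial n) i c → size (b [ i ]≔ just c) ≤ suc (size b)
size-update (nothing ∷ b) zero    c = ≤-refl
size-update (just d  ∷ b) zero    c = n≤1+n _
size-update (nothing ∷ b) (suc i) c = size-update b i c
size-update (just d  ∷ b) (suc i) c = s≤s (size-update b i c)

size-empty : ∀ n → size {n} (replicate n nothing) ≡ 0
size-empty zero    = refl
size-empty (suc n) = size-empty n

size-termCertificate : ∀ {n} (t : List (Fin n)) → size (termCertificate t) ≤ length t
size-termCertificate {n} []      = ≤-reflexive (size-empty n)
size-termCertificate     (i ∷ t) =
  ≤-trans (size-update (termCertificate t) i true) (s≤s (size-termCertificate t))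

termCertificate-fixed : ∀ {n} (t : List (Fin n)) j c →
  lookup (termCertificate t) j ≡ just c → c ≡ true × j ∈ t
termCertificate-fixed {n} [] j c e with () ← trans (sym (lookup-replicate j nothing)) e
termCertificate-fixed (i ∷ t) j c e with i ≟ j
... | yes refl with refl ← trans (sym (lookup∘update i (termCertificate t) (just true))) e =
  refl , here refl
... | no i≢j =
  let c≡true , j∈t = termCertificate-fixed t j c
                       (trans (sym (lookup∘update′ (≢-sym i≢j) (termCertificate t) (just true))) e)
  in c≡true , there j∈t

termCertificate-∈ : ∀ {n} (t : List (Fin n)) {j} → j ∈ t → lookup (termCertificate t) j ≡ just true
termCertificate-∈ (i ∷ t) {j} j∈ with i ≟ j
termCertificate-∈ (i ∷ t) {j} j∈          | yes refl = lookup∘update i (termCertificate t) (just true)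
termCertificate-∈ (i ∷ t) {j} (here refl) | no i≢j   = ⊥-elim (i≢j refl)
termCertificate-∈ (i ∷ t) {j} (there j∈t) | no i≢j   =
  trans (lookup∘update′ (≢-sym i≢j) (termCertificate t) (just true)) (termCertificate-∈ t j∈t)

==ᵇ-refl : ∀ a → IsTrue (a ==ᵇ a)
==ᵇ-refl true  = _
==ᵇ-refl false = _

==ᵇ-sound : ∀ {a c} → IsTrue (a ==ᵇ c) → c ≡ a
==ᵇ-sound {true}  {true}  _ = refl
==ᵇ-sound {false} {false} _ = refl

agrees-lookup : ∀ {n} (a : Input n) (b : Partial n) {i c} →
  IsTrue (agrees a b) → lookup b i ≡ just c → lookup a i ≡ c
agrees-lookup (x ∷ a) (just d  ∷ b) {zero}  ab refl = sym (==ᵇ-sound (proj₁ (Equivalence.to T-∧ ab)))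
agrees-lookup (x ∷ a) (nothing ∷ b) {suc i} ab bᵢ   = agrees-lookup a b ab bᵢ
agrees-lookup (x ∷ a) (just d  ∷ b) {suc i} ab bᵢ   =
  agrees-lookup a b (proj₂ (Equivalence.to (T-∧ {x ==ᵇ d}) ab)) bᵢ

agrees-intro : ∀ {n} (a : Input n) (b : Partial n) →
  (∀ i c → lookup b i ≡ just c → lookup a i ≡ c) → IsTrue (agrees a b)
agrees-intro []      []            h = _
agrees-intro (x ∷ a) (nothing ∷ b) h = agrees-intro a b (λ i c → h (suc i) c)
agrees-intro (x ∷ a) (just d  ∷ b) h = Equivalence.from T-∧
  (subst (λ z → IsTrue (z ==ᵇ d)) (sym (h zero d refl)) (==ᵇ-refl d) ,
   agrees-intro a b (λ i c → h (suc i) c))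

subsOf-extend : ∀ {n} (a : Bool) {l : List (Partial n)} {b} → b ∈ l →
  (nothing ∷ b) ∈ concatMap (λ v → (nothing ∷ v) ∷ (just a ∷ v) ∷ []) l ×
  (just a  ∷ b) ∈ concatMap (λ v → (nothing ∷ v) ∷ (just a ∷ v) ∷ []) l
subsOf-extend a (here refl) = here refl , there (here refl)
subsOf-extend a (there m)   = let p , q = subsOf-extend a m in there (there p) , there (there q)

subsOf-complete : ∀ {n} (x : Input n) (b : Partial n) → IsTrue (agrees x b) → b ∈ subsOf x
subsOf-complete []      []            _  = here refl
subsOf-complete (a ∷ x) (nothing ∷ b) xb = proj₁ (subsOf-extend a (subsOf-complete x b xb))
subsOf-complete (a ∷ x) (just c  ∷ b) xb
  with refl ← ==ᵇ-sound {a} {c} (proj₁ (Equivalence.to T-∧ xb)) =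
  proj₂ (subsOf-extend a (subsOf-complete x b (proj₂ (Equivalence.to (T-∧ {a ==ᵇ c}) xb))))

certificate-intro : ∀ {n} (f : BoolFun n) (b : Partial n) →
  (∀ a → IsTrue (agrees a b) → IsTrue (f a)) → IsTrue (isCertificate f b)
certificate-intro {n} f b forced =
  all⁻ _ {xs = inputs n} (All.tabulate (λ {a} _ →
    all⁻ _ {xs = inputs n} (All.tabulate (λ {a'} _ → constant a a'))))
  where
  value : ∀ a → agrees a b ≡ true → f a ≡ true
  value a ab = Equivalence.to T-≡ (forced a (Equivalence.from T-≡ ab))
  constant : ∀ a a' → IsTrue (not (agrees a b ∧ agrees a' b) ∨ (f a ==ᵇ f a'))
  constant a a' with agrees a b in ab | agrees a' b in a'b
  ... | false | _     = _
  ... | true  | false = _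
  ... | true  | true  rewrite value a ab | value a' a'b = _

module _ {n} (f : BoolFun n) where

  private
    improve : Partial n → ℕ → ℕ
    improve b m = if isCertificate f b then size b ⊓ m else m

    improve≤ : ∀ b m → improve b m ≤ m
    improve≤ b m with isCertificate f b
    ... | true  = m⊓n≤n (size b) m
    ... | false = ≤-refl

  minCert≤n : ∀ x → minCert f x ≤ n
  minCert≤n x = go (subsOf x)
    where
    go : ∀ (l : List (Partial n)) → foldr improve n l ≤ n
    go []      = ≤-refl
    go (b ∷ l) = ≤-trans (improve≤ b _) (go l)

  minCert≤size : ∀ x b → IsTrue (agrees x b) → IsTrue (isCertificate f b) → minCert f x ≤ size b
  minCert≤size x b xb cert = go (subsOf x) (subsOf-complete x b xb)
    where
    go : ∀ (l : List (Partial n)) → b ∈ l → foldr improve n l ≤ size b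
    go (b ∷ l) (here refl) rewrite Equivalence.to T-≡ cert = m⊓n≤m (size b) _
    go (c ∷ l) (there m)   = ≤-trans (improve≤ c _) (go l m)

-- a satisfied term is a certificate of the DNF
minCert≤term : ∀ {n} (F : DNF n) {t} → t ∈ F → ∀ x → IsTrue (satisfies x t) →
  minCert (evalDNF F) x ≤ length t
minCert≤term F {t} t∈F x sat = ≤-trans
  (minCert≤size (evalDNF F) x (termCertificate t)
    (agrees-intro x (termCertificate t) (λ i c fixed →
      let c≡true , i∈t = termCertificate-fixed t i c fixed
      in trans (Equivalence.to T-≡ (All.lookup (all⁺ (lookup x) t sat) i∈t)) (sym c≡true)))
    (certificate-intro (evalDNF F) (termCertificate t) (λ a a⊇t →
      any⁺ _ (lose t∈F (all⁻ (lookup a) (All.tabulate (λ j∈t →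
        subst IsTrue (sym (agrees-lookup a (termCertificate t) a⊇t (termCertificate-∈ t j∈t))) _)))))))
  (size-termCertificate t)

certificateBound : ∀ n k (F : DNF n) → (∀ t → t ∈ F → length t ≡ k) →
  totalCert (evalDNF F) ≤ k * ones (evalDNF F) + n * zeros (evalDNF F)
certificateBound n k F sizes = begin
    sumInputs n (minCert (evalDNF F))
  ≤⟨ sumOver-mono (inputs n) pointwise ⟩
    sumInputs n (λ x → k * 𝟙 (evalDNF F x) + n * 𝟙 (not (evalDNF F x)))
  ≡⟨ sumOver-+ (inputs n) _ _ ⟩
    sumInputs n (λ x → k * 𝟙 (evalDNF F x)) + sumInputs n (λ x → n * 𝟙 (not (evalDNF F x)))
  ≡⟨ cong₂ _+_ (sumOver-* (inputs n) k _) (sumOver-* (inputs n) n _) ⟩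
    k * ones (evalDNF F) + n * zeros (evalDNF F) ∎
  where
  open ≤-Reasoning
  pointwise : ∀ x → minCert (evalDNF F) x ≤ k * 𝟙 (evalDNF F x) + n * 𝟙 (not (evalDNF F x))
  pointwise x with evalDNF F x in Fx
  ... | true  =
    let t , t∈F , sat = find (any⁻ (satisfies x) F (Equivalence.from T-≡ Fx))
    in ≤-trans (minCert≤term F t∈F x sat)
         (subst (_≤ k * 1 + n * 0) (trans (*-identityʳ k) (sym (sizes t t∈F))) (m≤m+n (k * 1) (n * 0)))
  ... | false = ≤-trans (minCert≤n (evalDNF F) x)
                  (subst (_≤ k * 0 + n * 1) (*-identityʳ n) (m≤n+m (n * 1) (k * 0)))

sumOver-allFin : ∀ n (g : Fin (suc n) → ℕ) →
  sumOver (allFin (suc n)) g ≡ g zero + sumOver (allFin n) (λ i → g (suc i))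
sumOver-allFin n g =
  cong (g zero +_) (cong sum (trans (map-tabulate suc g) (sym (map-tabulate id (λ i → g (suc i))))))

sumOver-allFin-≟ : ∀ n (j : Fin n) → sumOver (allFin n) (λ i → 𝟙 (does (i ≟ j))) ≡ 1
sumOver-allFin-≟ (suc n) zero    =
  trans (sumOver-allFin n (λ i → 𝟙 (does (i ≟ zero)))) (cong suc (sumOver-const (allFin n) 0))
sumOver-allFin-≟ (suc n) (suc j) =
  trans (sumOver-allFin n (λ i → 𝟙 (does (i ≟ suc j)))) (sumOver-allFin-≟ n j)

sumOver-occurrencesIn : ∀ n (t : List (Fin n)) →
  sumOver (allFin n) (λ i → occurrencesIn i t) ≡ length t
sumOver-occurrencesIn n []      = sumOver-const (allFin n) 0
sumOver-occurrencesIn n (j ∷ t) =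
  trans (sumOver-cong (allFin n) (λ i → occurrencesIn-∷ i j t))
    (trans (sumOver-+ (allFin n) _ _)
      (cong₂ _+_ (sumOver-allFin-≟ n j) (sumOver-occurrencesIn n t)))

-- double counting: a formula with m terms of size k, in which each of the n variables
-- occurs exactly once, has n = k · m
variableCount : ∀ n k (F : DNF n) → (∀ t → t ∈ F → length t ≡ k) →
  (∀ i → occurrences i F ≡ 1) → n ≡ k * length F
variableCount n k F sizes once = begin
    n
  ≡⟨ sym (trans (sumOver-const (allFin n) 1) (trans (*-identityˡ _) (length-tabulate id))) ⟩
    sumOver (allFin n) (λ _ → 1)
  ≡⟨ sumOver-cong (allFin n) (λ i → sym (once i)) ⟩
    sumOver (allFin n) (λ i → sumOver F (occurrencesIn i))
  ≡⟨ sumOver-swap (allFin n) F occurrencesIn ⟩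
    sumOver F (λ t → sumOver (allFin n) (λ i → occurrencesIn i t))
  ≡⟨ sumOver-cong∈ F (λ t t∈F → trans (sumOver-occurrencesIn n t) (sizes t t∈F)) ⟩
    sumOver F (λ _ → k)
  ≡⟨ sumOver-const F k ⟩
    k * length F ∎
  where open ≡-Reasoning

-- Elementary estimates

n<2^n : ∀ n → n < 2 ^ n
n<2^n zero    = s≤s z≤n
n<2^n (suc n) =
  ≤-trans (+-mono-≤ (m^n>0 2 n) (n<2^n n)) (≤-reflexive (cong (2 ^ n +_) (sym (+-identityʳ (2 ^ n)))))

^-distribʳ-* : ∀ x y e → (x * y) ^ e ≡ x ^ e * y ^ e
^-distribʳ-* x y zero    = refl
^-distribʳ-* x y (suc e) rewrite ^-distribʳ-* x y e =
  solve 4 (λ a b c d → (a :* b) :* (c :* d) := (a :* c) :* (b :* d)) refl x y (x ^ e) (y ^ e)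

^-reflect-≤ : ∀ {x y} e → 1 ≤ e → x ^ e ≤ y ^ e → x ≤ y
^-reflect-≤ {x} {y} (suc e) _ le = ≮⇒≥ (λ y<x → <⇒≱ (^-monoˡ-< (suc e) y<x) le)

n≤n^e : ∀ n e → 1 ≤ e → n ≤ n ^ e
n≤n^e zero    e       _ = z≤n
n≤n^e (suc n) (suc e) _ =
  ≤-trans (≤-reflexive (sym (*-identityʳ (suc n)))) (*-monoʳ-≤ (suc n) (m^n>0 (suc n) e))

swap-^ : ∀ a b c → (a ^ b) ^ c ≡ (a ^ c) ^ b
swap-^ a b c = trans (^-*-assoc a b c) (trans (cong (a ^_) (*-comm b c)) (sym (^-*-assoc a c b)))

-- Bernoulli's inequality, cleared of denominators: (1 + 1/b)^p ≥ 1 + p/b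
bernoulli : ∀ b p → b ^ p * (b + p) ≤ b * suc b ^ p
bernoulli b zero    =
  ≤-reflexive (trans (+-identityʳ (b + 0)) (trans (+-identityʳ b) (sym (*-identityʳ b))))
bernoulli b (suc p) = begin
    b * b ^ p * (b + suc p)
  ≡⟨ solve 3 (λ b x p → b :* x :* (b :+ (con 1 :+ p)) := x :* (b :* b :+ b :* p :+ b))
       refl b (b ^ p) p ⟩
    b ^ p * (b * b + b * p + b)
  ≤⟨ m≤m+n _ (b ^ p * p) ⟩
    b ^ p * (b * b + b * p + b) + b ^ p * p
  ≡⟨ solve 3 (λ b x p → x :* (b :* b :+ b :* p :+ b) :+ x :* p := (con 1 :+ b) :* (x :* (b :+ p)))
       refl b (b ^ p) p ⟩
    suc b * (b ^ p * (b + p))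
  ≤⟨ *-monoʳ-≤ (suc b) (bernoulli b p) ⟩
    suc b * (b * suc b ^ p)
  ≡⟨ solve 2 (λ b y → (con 1 :+ b) :* (b :* y) := b :* ((con 1 :+ b) :* y)) refl b (suc b ^ p) ⟩
    b * suc b ^ suc p ∎
  where open ≤-Reasoning

-- (1 + 1/b)^b ≥ 2
doubling : ∀ b → 1 ≤ b → 2 * b ^ b ≤ suc b ^ b
doubling b@(suc _) _ = *-cancelˡ-≤ b (begin
    b * (2 * b ^ b)
  ≡⟨ solve 2 (λ b x → b :* (con 2 :* x) := x :* (b :+ b)) refl b (b ^ b) ⟩
    b ^ b * (b + b)
  ≤⟨ bernoulli b b ⟩
    b * suc b ^ b ∎)
  where open ≤-Reasoning

-- (1 + 1/b)^m ≥ 2^j whenever m ≥ b·j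
growth : ∀ b j m → 1 ≤ b → b * j ≤ m → 2 ^ j * b ^ m ≤ suc b ^ m
growth b j m 1≤b bj≤m = subst (λ m → 2 ^ j * b ^ m ≤ suc b ^ m) (m∸n+n≡m bj≤m) (begin
    2 ^ j * b ^ (r + b * j)
  ≡⟨ cong (2 ^ j *_) (^-distribˡ-+-* b r (b * j)) ⟩
    2 ^ j * (b ^ r * b ^ (b * j))
  ≡⟨ solve 3 (λ t x y → t :* (x :* y) := x :* (t :* y)) refl (2 ^ j) (b ^ r) (b ^ (b * j)) ⟩
    b ^ r * (2 ^ j * b ^ (b * j))
  ≤⟨ *-mono-≤ (^-monoˡ-≤ r (n≤1+n b)) (multiple j) ⟩
    suc b ^ r * suc b ^ (b * j)
  ≡⟨ sym (^-distribˡ-+-* (suc b) r (b * j)) ⟩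
    suc b ^ (r + b * j) ∎)
  where
  open ≤-Reasoning
  r = m ∸ b * j
  multiple : ∀ j → 2 ^ j * b ^ (b * j) ≤ suc b ^ (b * j)
  multiple zero    rewrite *-zeroʳ b = ≤-refl
  multiple (suc j) rewrite *-suc b j | ^-distribˡ-+-* b b (b * j) | ^-distribˡ-+-* (suc b) b (b * j) =
    begin
      2 * 2 ^ j * (b ^ b * b ^ (b * j))
    ≡⟨ solve 3 (λ t x y → con 2 :* t :* (x :* y) := (con 2 :* x) :* (t :* y))
         refl (2 ^ j) (b ^ b) (b ^ (b * j)) ⟩
      (2 * b ^ b) * (2 ^ j * b ^ (b * j))
    ≤⟨ *-mono-≤ (doubling b 1≤b) (multiple j) ⟩
      suc b ^ b * suc b ^ (b * j) ∎

eventuallyDominated : ∀ q c e → 1 ≤ q → ∃[ K ] (∀ k → K ≤ k → c * k ^ e * q ^ k ≤ suc q ^ k)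
eventuallyDominated q@(suc _) c e _ = c * L ^ e * L , dominated
  where
  L = q * suc e
  dominated : ∀ k → c * L ^ e * L ≤ k → c * k ^ e * q ^ k ≤ suc q ^ k
  dominated k K≤k = begin
      c * k ^ e * q ^ k
    ≤⟨ *-monoˡ-≤ (q ^ k) polynomial ⟩
      2 ^ j * q ^ k
    ≤⟨ growth q j k (s≤s z≤n) qj≤k ⟩
      suc q ^ k ∎
    where
    open ≤-Reasoning
    -- write k = (k mod L) + s·L and set j = s·(e + 1), so that s·L = q·j
    s = k / L
    j = s + s * e
    qj≤k : q * j ≤ k
    qj≤k = subst (_≤ k) (solve 3 (λ s q e → s :* (q :* (con 1 :+ e)) := q :* (s :+ s :* e)) refl s q e)
             (m/n*n≤m k L)
    k≤[1+s]L : k ≤ suc s * L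
    k≤[1+s]L = subst (_≤ suc s * L) (sym (m≡m%n+[m/n]*n k L))
                 (<⇒≤ (+-monoˡ-< (s * L) (m%n<n k L)))
    cLᵉ≤s : c * L ^ e ≤ s
    cLᵉ≤s = subst (_≤ s) (m*n/n≡m (c * L ^ e) L) (/-monoˡ-≤ L K≤k)
    polynomial : c * k ^ e ≤ 2 ^ j
    polynomial = begin
        c * k ^ e
      ≤⟨ *-monoʳ-≤ c (^-monoˡ-≤ e k≤[1+s]L) ⟩
        c * (suc s * L) ^ e
      ≡⟨ cong (c *_) (^-distribʳ-* (suc s) L e) ⟩
        c * (suc s ^ e * L ^ e)
      ≡⟨ solve 3 (λ c x y → c :* (x :* y) := (c :* y) :* x) refl c (suc s ^ e) (L ^ e) ⟩
        c * L ^ e * suc s ^ e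
      ≤⟨ *-mono-≤ (≤-trans cLᵉ≤s (<⇒≤ (n<2^n s))) (^-monoˡ-≤ e (n<2^n s)) ⟩
        2 ^ s * (2 ^ s) ^ e
      ≡⟨ cong (2 ^ s *_) (^-*-assoc 2 s e) ⟩
        2 ^ s * 2 ^ (s * e)
      ≡⟨ sym (^-distribˡ-+-* 2 s (s * e)) ⟩
        2 ^ j ∎

fewZeros : ∀ n k j (F : DNF n) → (∀ t → t ∈ F → length t ≡ k) → ReadOnce F → 1 ≤ k →
  2 ^ k * j ≤ length F → 2 ^ j * zeros (evalDNF F) ≤ 2 ^ n
fewZeros n k j F sizes readOnce 1≤k 2^kj≤m =
  *-cancelˡ-≤ (suc b ^ m) {{m^n≢0 (suc b) m}} (begin
    suc b ^ m * (2 ^ j * zeros (evalDNF F))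
  ≡⟨ solve 3 (λ a t z → a :* (t :* z) := t :* (a :* z)) refl (suc b ^ m) (2 ^ j) _ ⟩
    2 ^ j * (suc b ^ m * zeros (evalDNF F))
  ≡⟨ cong (2 ^ j *_) (subst (λ a → a ^ m * zeros (evalDNF F) ≡ b ^ m * 2 ^ n) 2^k≡1+b
       (zeros-readOnce n k b 2^k≡1+b F sizes readOnce)) ⟩
    2 ^ j * (b ^ m * 2 ^ n)
  ≡⟨ sym (*-assoc (2 ^ j) (b ^ m) (2 ^ n)) ⟩
    2 ^ j * b ^ m * 2 ^ n
  ≤⟨ *-monoˡ-≤ (2 ^ n) (growth b j m 1≤b (≤-trans (*-monoˡ-≤ j (m∸n≤m (2 ^ k) 1)) 2^kj≤m)) ⟩
    suc b ^ m * 2 ^ n ∎)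
  where
  open ≤-Reasoning
  m = length F
  b = 2 ^ k ∸ 1
  2^k≡1+b : 2 ^ k ≡ suc b
  2^k≡1+b = sym (m+[n∸m]≡n (m^n>0 2 k))
  1≤b : 1 ≤ b
  1≤b = ∸-monoˡ-≤ 1 (^-monoʳ-≤ 2 1≤k)

onesMajority : ∀ {n} (f : BoolFun n) c → 2 ≤ c → c * zeros f ≤ 2 ^ n → 2 ^ n ≤ 2 * ones f
onesMajority {n} f c 2≤c fewZ = +-cancelʳ-≤ (2 ^ n) (2 ^ n) (2 * ones f) (begin
    2 ^ n + 2 ^ n
  ≡⟨ cong (λ z → z + z) (sym (ones+zeros f)) ⟩
    ones f + zeros f + (ones f + zeros f)
  ≡⟨ solve 2 (λ a z → a :+ z :+ (a :+ z) := con 2 :* a :+ con 2 :* z) refl (ones f) (zeros f) ⟩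
    2 * ones f + 2 * zeros f
  ≤⟨ +-monoʳ-≤ (2 * ones f) (≤-trans (*-monoˡ-≤ (zeros f) 2≤c) fewZ) ⟩
    2 * ones f + 2 ^ n ∎)
  where open ≤-Reasoning

optLowerBound : ∀ n k (F : DNF n) → (∀ t → t ∈ F → length t ≡ k) → ReadOnce F → 1 ≤ k →
  2 ^ n ≤ 2 * ones (evalDNF F) →
  (T : DTree n) → Computes T (evalDNF F) → 2 ^ k * 2 ^ n ≤ 2 * totalCost T
optLowerBound n k F sizes readOnce 1≤k half T computes = begin
    2 ^ k * 2 ^ n
  ≤⟨ *-monoʳ-≤ (2 ^ k) half ⟩
    2 ^ k * (2 * ones (evalDNF F))
  ≡⟨ solve 2 (λ a s → a :* (con 2 :* s) := con 2 :* (a :* s)) refl (2 ^ k) (ones (evalDNF F)) ⟩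
    2 * (2 ^ k * ones (evalDNF F))
  ≤⟨ *-monoʳ-≤ 2 (costLowerBound n k F T computes sizes readOnce 1≤k) ⟩
    2 * totalCost T ∎
  where open ≤-Reasoning

certUpperBound : ∀ n k ℓ (F : DNF n) → (∀ t → t ∈ F → length t ≡ k) → 1 ≤ k → k ≤ ℓ →
  n * zeros (evalDNF F) ≤ 2 ^ n → totalCert (evalDNF F) ≤ 2 * ℓ * 2 ^ n
certUpperBound n k ℓ F sizes 1≤k k≤ℓ fewZ = begin
    totalCert (evalDNF F)
  ≤⟨ certificateBound n k F sizes ⟩
    k * ones (evalDNF F) + n * zeros (evalDNF F)
  ≤⟨ +-mono-≤ (*-mono-≤ k≤ℓ (m≤m+n _ _)) fewZ ⟩
    ℓ * (ones (evalDNF F) + zeros (evalDNF F)) + 2 ^ n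
  ≡⟨ cong (λ s → ℓ * s + 2 ^ n) (ones+zeros (evalDNF F)) ⟩
    ℓ * 2 ^ n + 2 ^ n
  ≤⟨ +-monoʳ-≤ (ℓ * 2 ^ n) (≤-trans (≤-reflexive (sym (*-identityˡ (2 ^ n))))
                             (*-monoˡ-≤ (2 ^ n) (≤-trans 1≤k k≤ℓ))) ⟩
    ℓ * 2 ^ n + ℓ * 2 ^ n
  ≡⟨ solve 2 (λ l t → l :* t :+ l :* t := con 2 :* l :* t) refl ℓ (2 ^ n) ⟩
    2 * ℓ * 2 ^ n ∎
  where open ≤-Reasoning

-- The asymptotic regime.  β = k₀ / log₂ n₀ with k₀ ≥ 1 and 2^k₀ < n₀, so 0 < β < 1;
-- the term size k = β log₂ n is expressed by n^k₀ = n₀^k.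
module Regime (n₀ k₀ : ℕ) (1≤k₀ : 1 ≤ k₀) (2^k₀<n₀ : 2 ^ k₀ < n₀) where

  1<n₀ : 1 < n₀
  1<n₀ = ≤-trans (s≤s (m^n>0 2 k₀)) 2^k₀<n₀

  dominance : ∃[ K ] (∀ k → K ≤ k → n₀ ^ k₀ * k ^ (k₀ + k₀) * (2 ^ k₀) ^ k ≤ suc (2 ^ k₀) ^ k)
  dominance = eventuallyDominated (2 ^ k₀) (n₀ ^ k₀) (k₀ + k₀) (m^n>0 2 k₀)

  threshold : ℕ
  threshold = n₀ ^ suc (proj₁ dominance)

  module _ {n k : ℕ} (n^k₀≡n₀^k : n ^ k₀ ≡ n₀ ^ k) where

    ≤n : ∀ {x} → x ^ k₀ ≤ n₀ ^ k → x ≤ n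
    ≤n le = ^-reflect-≤ k₀ 1≤k₀ (≤-trans le (≤-reflexive (sym n^k₀≡n₀^k)))

    2^k≤n : 2 ^ k ≤ n
    2^k≤n = ≤n (≤-trans (≤-reflexive (swap-^ 2 k k₀)) (^-monoˡ-≤ k (<⇒≤ 2^k₀<n₀)))

    2≤n : 1 ≤ k → 2 ≤ n
    2≤n 1≤k = ≤-trans (^-monoʳ-≤ 2 1≤k) 2^k≤n

    k≤⌈log₂n⌉ : k ≤ ⌈log₂ n ⌉
    k≤⌈log₂n⌉ = subst (_≤ ⌈log₂ n ⌉) (⌈log₂2^n⌉≡n k) (⌈log₂⌉-mono-≤ 2^k≤n)

    n≤2^[n₀k] : n ≤ 2 ^ (n₀ * k)
    n≤2^[n₀k] = begin
        n           ≤⟨ n≤n^e n k₀ 1≤k₀ ⟩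
        n ^ k₀      ≡⟨ n^k₀≡n₀^k ⟩
        n₀ ^ k      ≤⟨ ^-monoˡ-≤ k (<⇒≤ (n<2^n n₀)) ⟩
        (2 ^ n₀) ^ k ≡⟨ ^-*-assoc 2 n₀ k ⟩
        2 ^ (n₀ * k) ∎
      where open ≤-Reasoning

    n₀k²2^k≤n : threshold ≤ n → n₀ * (k * k) * 2 ^ k ≤ n
    n₀k²2^k≤n N≤n = ≤n (begin
        (n₀ * (k * k) * 2 ^ k) ^ k₀
      ≡⟨ ^-distribʳ-* (n₀ * (k * k)) (2 ^ k) k₀ ⟩
        (n₀ * (k * k)) ^ k₀ * (2 ^ k) ^ k₀
      ≡⟨ cong₂ _*_ (trans (^-distribʳ-* n₀ (k * k) k₀)
           (cong (n₀ ^ k₀ *_) (trans (^-distribʳ-* k k k₀) (sym (^-distribˡ-+-* k k₀ k₀)))))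
           (swap-^ 2 k k₀) ⟩
        n₀ ^ k₀ * k ^ (k₀ + k₀) * (2 ^ k₀) ^ k
      ≤⟨ proj₂ dominance k K≤k ⟩
        suc (2 ^ k₀) ^ k
      ≤⟨ ^-monoˡ-≤ k 2^k₀<n₀ ⟩
        n₀ ^ k ∎)
      where
      open ≤-Reasoning
      K≤k : proj₁ dominance ≤ k
      K≤k = ≮⇒≥ (λ k<K → <⇒≱ (^-monoʳ-< n₀ 1<n₀ (≤-trans k<K (n≤1+n _)))
              (≤-trans N≤n (≤-trans (n≤n^e n k₀ 1≤k₀) (≤-reflexive n^k₀≡n₀^k))))

    manyTerms : ∀ m → n ≡ k * m → 1 ≤ k → threshold ≤ n → 2 ^ k * (n₀ * k) ≤ m
    manyTerms m n≡km 1≤k N≤n = *-cancelˡ-≤ k {{>-nonZero 1≤k}}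
      (subst₂ _≤_ (solve 3 (λ n₀ k a → n₀ :* (k :* k) :* a := k :* (a :* (n₀ :* k))) refl n₀ k (2 ^ k))
                  n≡km (n₀k²2^k≤n N≤n))

-- Theorem 6: E_f[OPT] = Ω(n^β) (with n^β = 2^k and constant d = 2) and
-- E_f[CERT] = O(log n) (with constant C = 2), for all n beyond the threshold.
theorem6 : (n₀ k₀ : ℕ) → 1 ≤ k₀ → 2 ^ k₀ < n₀ →
    ∃[ d ] ∃[ C ] ∃[ N ] (1 ≤ d ×
      ((n k : ℕ) → N ≤ n → 1 ≤ k → k ∣ n → n ^ k₀ ≡ n₀ ^ k →
        (F : DNF n) → RegularReadOnce k F →
        ((T : DTree n) → Computes T (evalDNF F) → 2 ^ k * 2 ^ n ≤ d * totalCost T)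
        × (totalCert (evalDNF F) ≤ C * ⌈log₂ n ⌉ * 2 ^ n)))
theorem6 n₀ k₀ 1≤k₀ 2^k₀<n₀ = 2 , 2 , threshold , s≤s z≤n , bounds
  where
  open Regime n₀ k₀ 1≤k₀ 2^k₀<n₀
  bounds : (n k : ℕ) → threshold ≤ n → 1 ≤ k → k ∣ n → n ^ k₀ ≡ n₀ ^ k →
    (F : DNF n) → RegularReadOnce k F →
    ((T : DTree n) → Computes T (evalDNF F) → 2 ^ k * 2 ^ n ≤ 2 * totalCost T)
    × (totalCert (evalDNF F) ≤ 2 * ⌈log₂ n ⌉ * 2 ^ n)
  bounds n k N≤n 1≤k _ n^k₀≡n₀^k F (sizes , once) =
      optLowerBound n k F sizes readOnce 1≤k
        (onesMajority (evalDNF F) n (2≤n n^k₀≡n₀^k 1≤k) n·zeros≤2^n)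
    , certUpperBound n k ⌈log₂ n ⌉ F sizes 1≤k (k≤⌈log₂n⌉ n^k₀≡n₀^k) n·zeros≤2^n
    where
    readOnce : ReadOnce F
    readOnce i = ≤-reflexive (once i)
    -- Pr[F = 0] ≤ 2^-(n₀ k) ≤ 1/n
    n·zeros≤2^n : n * zeros (evalDNF F) ≤ 2 ^ n
    n·zeros≤2^n = ≤-trans (*-monoˡ-≤ _ (n≤2^[n₀k] n^k₀≡n₀^k))
      (fewZeros n k (n₀ * k) F sizes readOnce 1≤k
        (manyTerms n^k₀≡n₀^k (length F) (variableCount n k F sizes once) 1≤k N≤n))
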